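{- Let $X,Y$ be types, $\varepsilon\colon\mathbb{N}\to(X\to Y)\to X$, $q\colon X^{\mathbb{N}}\to Y$, $\varphi\colon X^{\mathbb{N}}\to\mathbb{N}$, and let $\Psi=\Psi^{\varepsilon,q,\varphi}\colon X^\dagger\to X^\dagger$ satisfy, for all $u\colon X^\dagger$, $$\Psi(u)=u\,@\begin{cases}\emptyset&\text{if }n_u\in\mathrm{dom}(u),\\ \Psi(u\oplus(n_u,a_u))&\text{otherwise,}\end{cases}$$ where $n_u=\varphi(\hat u)$ and $a_u=\varepsilon_{n_u}\big(\lambda x.\,\hat q(\Psi(u\oplus(n_u,x)))\big)$. Suppose $u\colon X^\dagger$ is a $\varphi$-thread and let $v:=\Psi(u)$. Then $v=\Psi([v]^{\varphi}_{i})$ for all $i$ with $|\mathrm{dom}(u)|\le i\le|\mathrm{dom}(v)|$.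
   Context: The setting is $\mathsf{E\text{ - }HA}^\omega$ (extensional Heyting arithmetic in all finite types) extended by a constant $\Psi$ with the displayed defining equation. $X^{\mathbb{N}}$ is $\mathbb{N}\to X$; $X^\dagger$ is the type of finite partial functions from $\mathbb{N}$ to $X$ with decidable finite domain $\mathrm{dom}(u)$, $|\mathrm{dom}(u)|$ its cardinality; $\emptyset$ is the nowhere-defined one. $\mathbf{0}_X$ is the canonical element of $X$; $\hat u\colon X^{\mathbb{N}}$ agrees with $u$ on $\mathrm{dom}(u)$ and is $\mathbf{0}_X$ elsewhere; $\hat q(u):=q(\hat u)$, $\hat\varphi(u):=\varphi(\hat u)$. $\varepsilon_n$ means $\varepsilon(n)$. $u\oplus(n,x)$ equals $u$ if $n\in\mathrm{dom}(u)$, otherwise $u$ extended with value $x$ at $n$. $u\,@\,w$ is the union of the partial functions $u,w$, taking the value of $u$ where both are defined. The $\varphi$-thread of $u$: $[u]^{\varphi}_{0}=\emptyset$, $[u]^{\varphi}_{i+1}=[u]^{\varphi}_{i}\oplus(n_i,u(n_i))$ if $n_i\in\mathrm{dom}(u)$ and $[u]^{\varphi}_{i}$ otherwise, with $n_i:=\hat\varphi([u]^{\varphi}_{i})$; $u$ is a $\varphi$-thread iff $u=[u]^{\varphi}_{|\mathrm{dom}(u)|}$. -}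

module Defs where

open import Data.Nat using (ℕ; zero; suc; _≤_; _<_; _⊔_; _≟_)
open import Data.Bool using (Bool; true; false; if_then_else_)
open import Data.Maybe using (Maybe; just; nothing; is-just; maybe)
open import Relation.Nullary using (yes; no; does)
open import Relation.Binary.PropositionalEquality using (_≡_)

Seq : Set → Set
Seq X = ℕ → X

-- X† : finite partial functions ℕ ⇀ X with decidable finite domain.
-- Represented by a Maybe-valued function together with a bound beyond
-- which it is undefined.
record Fin† (X : Set) : Set where
  constructor mk†
  field
    bound   : ℕ
    fun     : ℕ → Maybe X
    bounded : ∀ n → bound ≤ n → fun n ≡ nothing
open Fin† public

module _ {X : Set} where

  _≈†_ : Fin† X → Fin† X → Set
  u ≈† w = ∀ n → fun u n ≡ fun w n
  infix 4 _≈†_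

  inDom : ℕ → Fin† X → Bool
  inDom n u = is-just (fun u n)

  ∅ : Fin† X
  ∅ = mk† 0 (λ _ → nothing) (λ _ _ → _≡_.refl)

  countBelow : (ℕ → Maybe X) → ℕ → ℕ
  countBelow f zero = zero
  countBelow f (suc k) = (if is-just (f k) then suc else (λ m → m)) (countBelow f k)

  ∣dom_∣ : Fin† X → ℕ
  ∣dom u ∣ = countBelow (fun u) (bound u)

  -- û : X^N, agreeing with u on dom(u) and 0_X elsewhere
  hat : (x₀ : X) → Fin† X → Seq X
  hat x₀ u n = maybe (λ x → x) x₀ (fun u n)

  open import Data.Nat.Properties using (m⊔n≤o⇒m≤o; m⊔n≤o⇒n≤o; ≤-trans; n≤1+n; <⇒≢; ≤-refl)
  open import Relation.Binary.PropositionalEquality using (refl; sym)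
  open import Relation.Nullary using (Dec)

  ⊕fun : Fin† X → ℕ → X → ℕ → Maybe X
  ⊕fun u n x m with fun u m
  ... | just y  = just y
  ... | nothing with m ≟ n
  ...   | yes _ = just x
  ...   | no _  = nothing

  _⊕_ : Fin† X → ℕ → X → Fin† X
  _⊕_ u n x = mk† (bound u ⊔ suc n) (⊕fun u n x) pf
    where
    pf : ∀ m → bound u ⊔ suc n ≤ m → ⊕fun u n x m ≡ nothing
    pf m le with fun u m | bounded u m (m⊔n≤o⇒m≤o (bound u) (suc n) le)
    ... | nothing | _ with m ≟ n
    ...   | no _ = refl
    ...   | yes refl with () ← <⇒≢ (m⊔n≤o⇒n≤o (bound u) (suc n) le) refl

  unionFun : Fin† X → Fin† X → ℕ → Maybe X
  unionFun u w m with fun u m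
  ... | just y  = just y
  ... | nothing = fun w m

  _∪ₗ_ : Fin† X → Fin† X → Fin† X
  u ∪ₗ w = mk† (bound u ⊔ bound w) (unionFun u w) pf
    where
    pf : ∀ m → bound u ⊔ bound w ≤ m → unionFun u w m ≡ nothing
    pf m le with fun u m | bounded u m (m⊔n≤o⇒m≤o (bound u) (bound w) le)
    ... | nothing | _ = bounded w m (m⊔n≤o⇒n≤o (bound u) (bound w) le)

  thread : (x₀ : X) → (Seq X → ℕ) → Fin† X → ℕ → Fin† X
  thread x₀ φ u zero = ∅
  thread x₀ φ u (suc i) with fun u (φ (hat x₀ (thread x₀ φ u i)))
  ... | just a  = (thread x₀ φ u i ⊕ φ (hat x₀ (thread x₀ φ u i))) a
  ... | nothing = thread x₀ φ u i

  IsThread : (x₀ : X) → (Seq X → ℕ) → Fin† X → Set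
  IsThread x₀ φ u = u ≈† thread x₀ φ u ∣dom u ∣

-- Extensionality (holds for every term in E-HA^ω by the extensionality axiom)
module _ {X Y : Set} where
  open import Data.Nat using (ℕ)
  open import Relation.Binary.PropositionalEquality using (_≡_)

  ExtSeq : {Z : Set} → (Seq X → Z) → Set
  ExtSeq f = ∀ α β → (∀ n → α n ≡ β n) → f α ≡ f β

  ExtSel : (ℕ → (X → Y) → X) → Set
  ExtSel ε = ∀ n f g → (∀ x → f x ≡ g x) → ε n f ≡ ε n g

  Ext† : (Fin† X → Fin† X) → Set
  Ext† Ψ = ∀ u w → u ≈† w → Ψ u ≈† Ψ w

  PsiEquation : (x₀ : X) → (ℕ → (X → Y) → X) → (Seq X → Y) → (Seq X → ℕ)
              → (Fin† X → Fin† X) → Set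
  PsiEquation x₀ ε q φ Ψ = ∀ u →
    let nᵤ = φ (hat x₀ u)
        aᵤ = ε nᵤ (λ x → q (hat x₀ (Ψ ((u ⊕ nᵤ) x))))
    in Ψ u ≈† (u ∪ₗ (if inDom nᵤ u then ∅ else Ψ ((u ⊕ nᵤ) aᵤ)))

module Submission where

-- Lemma 3.4.  Write T v i for the φ-thread [v]^φ_i and let v = Ψ u.
--
-- (1) Ψ extends its argument (w ⊆ Ψ w): immediate from the defining equation.
-- (2) Fixed points propagate along threads: Ψ (T v i) ≈ v implies
--     Ψ (T v (i+1)) ≈ v.  If the next position n is outside dom v, or already
--     in T v i, the thread does not move (up to ≈).  Otherwise the equation
--     for Ψ (T v i) shows v(n) = a_{T v i}, so T v (i+1) is exactly the
--     argument of the recursive call, whose value is Ψ (T v i) ≈ v.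
-- (3) Base case i = |dom u|.  A φ-thread u never gets stuck before step
--     |dom u| (a stuck thread stays constant, so it has at most j points at
--     step j); hence any v ⊇ u takes the same first |dom u| thread steps as u,
--     T v |dom u| ≈ u, and Ψ (T v |dom u|) ≈ Ψ u = v.

open import Defs
open import Data.Nat using (ℕ; zero; suc; _≤_; _<_; _≤′_; ≤′-refl; ≤′-step; _+_; _∸_; _⊔_; _≟_; z≤n; s≤s)
open import Data.Nat.Properties
open import Data.Bool using (true; false; if_then_else_)
open import Data.Maybe using (Maybe; just; nothing; is-just)
open import Data.Empty using (⊥-elim)
open import Data.Product using (_,_; ∃)
open import Relation.Nullary using (yes; no; ¬_)
open import Relation.Binary.PropositionalEquality

module PartialFunctions {X : Set} where

  ≈-sym : (u w : Fin† X) → u ≈† w → w ≈† u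
  ≈-sym u w e n = sym (e n)

  ≈-trans : (u w z : Fin† X) → u ≈† w → w ≈† z → u ≈† z
  ≈-trans u w z e f n = trans (e n) (f n)

  _⊆_ : Fin† X → Fin† X → Set
  u ⊆ w = ∀ m {y} → fun u m ≡ just y → fun w m ≡ just y

  ⊆-⊕ : (u : Fin† X) (n : ℕ) (a : X) → u ⊆ (u ⊕ n) a
  ⊆-⊕ u n a m e rewrite e = refl

  ⊕-new : (u : Fin† X) (n : ℕ) (a : X) → fun u n ≡ nothing → fun ((u ⊕ n) a) n ≡ just a
  ⊕-new u n a fresh rewrite fresh with n ≟ n
  ... | yes _ = refl
  ... | no n≢n = ⊥-elim (n≢n refl)

  ⊕-old : (u : Fin† X) (n : ℕ) (a c : X) → fun u n ≡ just c → (u ⊕ n) a ≈† u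
  ⊕-old u n a c old m with fun u m in e
  ... | just _ = refl
  ... | nothing with m ≟ n
  ...   | yes refl with () ← trans (sym old) e
  ...   | no _ = refl

  ⊕-cong : (u w : Fin† X) (n : ℕ) (a : X) → u ≈† w → (u ⊕ n) a ≈† (w ⊕ n) a
  ⊕-cong u w n a e m rewrite e m = refl

  ∪-⊆ˡ : (u w : Fin† X) → u ⊆ (u ∪ₗ w)
  ∪-⊆ˡ u w m e rewrite e = refl

  ∪-absorb : (u w : Fin† X) → u ⊆ w → (u ∪ₗ w) ≈† w
  ∪-absorb u w u⊆w m with fun u m in e
  ... | just y = sym (u⊆w m e)
  ... | nothing = refl

  hat-cong : (x₀ : X) (u w : Fin† X) → u ≈† w → ∀ n → hat x₀ u n ≡ hat x₀ w n
  hat-cong x₀ u w e n rewrite e n = refl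

open PartialFunctions

module Counting {X : Set} where

  countBelow-cong : (f g : ℕ → Maybe X) → (∀ n → f n ≡ g n) → ∀ k → countBelow f k ≡ countBelow g k
  countBelow-cong f g e zero = refl
  countBelow-cong f g e (suc k) rewrite e k | countBelow-cong f g e k = refl

  countBelow-stable : (u : Fin† X) (k : ℕ) → bound u ≤ k → countBelow (fun u) k ≡ ∣dom u ∣
  countBelow-stable u k b≤k =
    trans (cong (countBelow (fun u)) (sym (m+[n∸m]≡n b≤k))) (beyond (k ∸ bound u))
    where
      beyond : ∀ d → countBelow (fun u) (bound u + d) ≡ ∣dom u ∣
      beyond zero rewrite +-identityʳ (bound u) = refl
      beyond (suc d) rewrite +-suc (bound u) d | bounded u (bound u + d) (m≤m+n _ d) = beyond d

  ∣dom∣-cong : (u w : Fin† X) → u ≈† w → ∣dom u ∣ ≡ ∣dom w ∣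
  ∣dom∣-cong u w e = begin
      ∣dom u ∣                    ≡⟨ countBelow-stable u k (m≤m⊔n _ _) ⟨
      countBelow (fun u) k        ≡⟨ countBelow-cong (fun u) (fun w) e k ⟩
      countBelow (fun w) k        ≡⟨ countBelow-stable w k (m≤n⊔m _ _) ⟩
      ∣dom w ∣                    ∎
    where
      open ≡-Reasoning
      k = bound u ⊔ bound w

  countBelow-suc-≤ : (f : ℕ → Maybe X) (k : ℕ) → countBelow f (suc k) ≤ suc (countBelow f k)
  countBelow-suc-≤ f k with is-just (f k)
  ... | true = ≤-refl
  ... | false = n≤1+n _

  countBelow-≤-suc : (f : ℕ → Maybe X) (k : ℕ) → countBelow f k ≤ countBelow f (suc k)
  countBelow-≤-suc f k with is-just (f k)
  ... | true = n≤1+n _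
  ... | false = ≤-refl

  countBelow-mono : (f g : ℕ → Maybe X) (k : ℕ) →
    (∀ m → m < k → is-just (g m) ≡ true → is-just (f m) ≡ true) →
    countBelow g k ≤ countBelow f k
  countBelow-mono f g zero sub = z≤n
  countBelow-mono f g (suc k) sub with is-just (g k) in gk
  ... | false = ≤-trans (countBelow-mono f g k sub′) (countBelow-≤-suc f k)
    where sub′ = λ m m<k → sub m (m<n⇒m<1+n m<k)
  ... | true rewrite sub k ≤-refl gk = s≤s (countBelow-mono f g k sub′)
    where sub′ = λ m m<k → sub m (m<n⇒m<1+n m<k)

  countBelow-one-more : (f g : ℕ → Maybe X) (n : ℕ) →
    (∀ m → ¬ m ≡ n → is-just (g m) ≡ true → is-just (f m) ≡ true) →
    ∀ k → countBelow g k ≤ suc (countBelow f k)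
  countBelow-one-more f g n sub zero = z≤n
  countBelow-one-more f g n sub (suc k) with k ≟ n
  ... | yes refl = ≤-trans (countBelow-suc-≤ g k)
                     (s≤s (≤-trans (countBelow-mono f g k (λ m m<k → sub m (<⇒≢ m<k)))
                                   (countBelow-≤-suc f k)))
  ... | no k≢n with is-just (g k) in gk
  ...   | false = ≤-trans (countBelow-one-more f g n sub k) (s≤s (countBelow-≤-suc f k))
  ...   | true rewrite sub k k≢n gk = s≤s (countBelow-one-more f g n sub k)

  ⊕-dom : (u : Fin† X) (n : ℕ) (a : X) (m : ℕ) → ¬ m ≡ n →
    is-just (⊕fun u n a m) ≡ true → is-just (fun u m) ≡ true
  ⊕-dom u n a m m≢n e with fun u m
  ... | just _ = refl
  ... | nothing with m ≟ n
  ...   | yes m≡n = ⊥-elim (m≢n m≡n)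
  ...   | no _ = e

  ∣dom-⊕∣ : (u : Fin† X) (n : ℕ) (a : X) → ∣dom (u ⊕ n) a ∣ ≤ suc ∣dom u ∣
  ∣dom-⊕∣ u n a =
    ≤-trans (countBelow-one-more (fun u) (⊕fun u n a) n (⊕-dom u n a) k)
            (s≤s (≤-reflexive (countBelow-stable u k (m≤m⊔n _ _))))
    where k = bound u ⊔ suc n

open Counting

module Threads {X : Set} (x₀ : X) (φ : Seq X → ℕ) where

  T : Fin† X → ℕ → Fin† X
  T = thread x₀ φ

  pos : Fin† X → ℕ
  pos w = φ (hat x₀ w)

  thread-stuck : (u : Fin† X) (j : ℕ) → fun u (pos (T u j)) ≡ nothing → T u (suc j) ≡ T u j
  thread-stuck u j e rewrite e = refl

  thread-extend : (u : Fin† X) (j : ℕ) (a : X) → fun u (pos (T u j)) ≡ just a →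
    T u (suc j) ≡ (T u j ⊕ pos (T u j)) a
  thread-extend u j a e rewrite e = refl

  ∣dom-thread∣ : (u : Fin† X) (j : ℕ) → ∣dom T u j ∣ ≤ j
  ∣dom-thread∣ u zero = z≤n
  ∣dom-thread∣ u (suc j) with fun u (pos (T u j))
  ... | just a = ≤-trans (∣dom-⊕∣ (T u j) _ a) (s≤s (∣dom-thread∣ u j))
  ... | nothing = m≤n⇒m≤1+n (∣dom-thread∣ u j)

  stuck-forever : (u : Fin† X) (j : ℕ) → fun u (pos (T u j)) ≡ nothing →
    ∀ d → T u (j + d) ≡ T u j
  stuck-forever u j e zero = cong (T u) (+-identityʳ j)
  stuck-forever u j e (suc d) = begin
      T u (j + suc d)    ≡⟨ cong (T u) (+-suc j d) ⟩
      T u (suc (j + d))  ≡⟨ thread-stuck u (j + d) stuck ⟩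
      T u (j + d)        ≡⟨ same ⟩
      T u j              ∎
    where
      open ≡-Reasoning
      same = stuck-forever u j e d
      stuck : fun u (pos (T u (j + d))) ≡ nothing
      stuck = subst (λ t → fun u (pos t) ≡ nothing) (sym same) e

  -- A φ-thread u is never stuck before step |dom u|: otherwise it would
  -- coincide with a stage that has at most j < |dom u| points.
  thread-unstuck : (u : Fin† X) → IsThread x₀ φ u → (j : ℕ) → j < ∣dom u ∣ →
    ∃ λ a → fun u (pos (T u j)) ≡ just a
  thread-unstuck u th j j<m with fun u (pos (T u j)) in e
  ... | just a = a , refl
  ... | nothing = ⊥-elim (<⇒≱ j<m m≤j)
    where
      open ≤-Reasoning
      m≤j : ∣dom u ∣ ≤ j
      m≤j = begin
        ∣dom u ∣                          ≡⟨ ∣dom∣-cong u (T u ∣dom u ∣) th ⟩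
        ∣dom T u ∣dom u ∣ ∣                ≡⟨ cong (λ k → ∣dom T u k ∣) (m+[n∸m]≡n (<⇒≤ j<m)) ⟨
        ∣dom T u (j + (∣dom u ∣ ∸ j)) ∣    ≡⟨ cong ∣dom_∣ (stuck-forever u j e _) ⟩
        ∣dom T u j ∣                       ≤⟨ ∣dom-thread∣ u j ⟩
        j                                  ∎

  thread-agree : (∀ α β → (∀ n → α n ≡ β n) → φ α ≡ φ β) →
    {u v : Fin† X} → IsThread x₀ φ u → u ⊆ v →
    (j : ℕ) → j ≤ ∣dom u ∣ → T v j ≈† T u j
  thread-agree eφ th u⊆v zero _ _ = refl
  thread-agree eφ {u} {v} th u⊆v (suc j) j<m with thread-unstuck u th j j<m
  ... | a , ua = λ m → begin
      fun (T v (suc j)) m                   ≡⟨ cong (λ t → fun t m) (thread-extend v j a va) ⟩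
      fun ((T v j ⊕ pos (T v j)) a) m       ≡⟨ cong (λ n → fun ((T v j ⊕ n) a) m) same-pos ⟩
      fun ((T v j ⊕ pos (T u j)) a) m       ≡⟨ ⊕-cong (T v j) (T u j) (pos (T u j)) a earlier m ⟩
      fun ((T u j ⊕ pos (T u j)) a) m       ≡⟨ cong (λ t → fun t m) (thread-extend u j a ua) ⟨
      fun (T u (suc j)) m                   ∎
    where
      open ≡-Reasoning
      earlier : T v j ≈† T u j
      earlier = thread-agree eφ th u⊆v j (<⇒≤ j<m)
      same-pos : pos (T v j) ≡ pos (T u j)
      same-pos = eφ _ _ (hat-cong x₀ (T v j) (T u j) earlier)
      va : fun v (pos (T v j)) ≡ just a
      va = trans (cong (fun v) same-pos) (u⊆v _ ua)

module PsiFacts {X Y : Set} (x₀ : X)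
    (ε : ℕ → (X → Y) → X) (q : Seq X → Y) (φ : Seq X → ℕ)
    (Ψ : Fin† X → Fin† X) (eΨ : Ext† {X} {Y} Ψ)
    (ψ-eq : PsiEquation x₀ ε q φ Ψ) where

  open Threads x₀ φ

  choice : Fin† X → X
  choice w = ε (pos w) (λ x → q (hat x₀ (Ψ ((w ⊕ pos w) x))))

  Ψ-extends : (w : Fin† X) → w ⊆ Ψ w
  Ψ-extends w m e = trans (ψ-eq w m) (∪-⊆ˡ w _ m e)

  Ψ-fresh : (w : Fin† X) → fun w (pos w) ≡ nothing →
    Ψ w ≈† Ψ ((w ⊕ pos w) (choice w))
  Ψ-fresh w fresh m = begin
      fun (Ψ w) m                                        ≡⟨ ψ-eq w m ⟩
      fun (w ∪ₗ (if inDom (pos w) w then ∅ else Ψ z)) m  ≡⟨ cong recursive-branch fresh ⟩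
      fun (w ∪ₗ Ψ z) m                                   ≡⟨ ∪-absorb w (Ψ z) w⊆Ψz m ⟩
      fun (Ψ z) m                                        ∎
    where
      open ≡-Reasoning
      z = (w ⊕ pos w) (choice w)
      recursive-branch : Maybe X → Maybe X
      recursive-branch b = fun (w ∪ₗ (if is-just b then ∅ else Ψ z)) m
      w⊆Ψz : w ⊆ Ψ z
      w⊆Ψz k e = Ψ-extends z k (⊆-⊕ w _ _ k e)

  fixpoint-step : (v : Fin† X) (i : ℕ) → Ψ (T v i) ≈† v → Ψ (T v (suc i)) ≈† v
  fixpoint-step v i h with fun v (pos (T v i)) in vn
  ... | nothing = h
  ... | just b with fun (T v i) (pos (T v i)) in wn
  ...   | just c = ≈-trans (Ψ ((T v i ⊕ pos (T v i)) b)) (Ψ (T v i)) v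
                       (eΨ _ _ (⊕-old (T v i) _ b c wn)) h
  ...   | nothing = extend-by-choice b≡a
    where
      w = T v i
      a = choice w
      z = (w ⊕ pos w) a
      b≡a : just b ≡ just a
      b≡a = begin
        just b                                ≡⟨ vn ⟨
        fun v (pos w)                         ≡⟨ h (pos w) ⟨
        fun (Ψ w) (pos w)                     ≡⟨ Ψ-fresh w wn (pos w) ⟩
        fun (Ψ z) (pos w)                     ≡⟨ Ψ-extends z (pos w) (⊕-new w (pos w) a wn) ⟩
        just a                                ∎
        where open ≡-Reasoning
      extend-by-choice : just b ≡ just a → Ψ ((w ⊕ pos w) b) ≈† v
      extend-by-choice refl = ≈-trans (Ψ z) (Ψ w) v (≈-sym (Ψ w) (Ψ z) (Ψ-fresh w wn)) h

  fixpoint-from : (v : Fin† X) {m i : ℕ} → Ψ (T v m) ≈† v → m ≤′ i → Ψ (T v i) ≈† v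
  fixpoint-from v h ≤′-refl = h
  fixpoint-from v h (≤′-step m≤i) = fixpoint-step v _ (fixpoint-from v h m≤i)

lemma3p4 : {X Y : Set} (x₀ : X)
    (ε : ℕ → (X → Y) → X) (q : Seq X → Y) (φ : Seq X → ℕ)
    (Ψ : Fin† X → Fin† X) →
    ExtSel {X} {Y} ε → ExtSeq {X} {Y} q → ExtSeq {X} {Y} φ → Ext† {X} {Y} Ψ →
    PsiEquation x₀ ε q φ Ψ →
    (u : Fin† X) → IsThread x₀ φ u →
    (i : ℕ) → ∣dom u ∣ ≤ i → i ≤ ∣dom Ψ u ∣ →
    Ψ u ≈† Ψ (thread x₀ φ (Ψ u) i)
lemma3p4 x₀ ε q φ Ψ _ _ eφ eΨ ψ-eq u th i m≤i _ =
  ≈-sym (Ψ (thread x₀ φ (Ψ u) i)) (Ψ u) (fixpoint-from (Ψ u) base (≤⇒≤′ m≤i))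
  where
    open Threads x₀ φ
    open PsiFacts x₀ ε q φ Ψ eΨ ψ-eq
    m = ∣dom u ∣
    base : Ψ (T (Ψ u) m) ≈† Ψ u
    base = eΨ _ _ (≈-trans (T (Ψ u) m) (T u m) u
                    (thread-agree eφ th (Ψ-extends u) m ≤-refl) (≈-sym u (T u m) th))
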